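{- The convex coloring polynomial $C(G;x)$ and the adjoint polynomial $A(G;x)$ are not multiplicative (there are graphs $G_1,G_2$ with $F(G_1\sqcup G_2;x)\neq F(G_1;x)F(G_2;x)$ for $F\in\{C,A\}$); hence neither is an edge elimination invariant.
   Context: All graphs are finite simple graphs. For a graph property $\mathcal{P}$ (class of graphs closed under isomorphism) and graph $G$, $b_i^{\mathcal{P}}(G)$ is the number of partitions of $V(G)$ into $i$ nonempty blocks each inducing a graph in $\mathcal{P}$, and $\chi_{\mathcal{P}}(G;x)=\sum_i b_i^{\mathcal{P}}(G)\,x_{(i)}$ with $x_{(i)}=x(x-1)\cdots(x-i+1)$. $C(G;x)=\chi_{\mathcal{P}}(G;x)$ for $\mathcal{P}$ the class of connected graphs, and $A(G;x)=\chi_{\mathcal{P}}(G;x)$ for $\mathcal{P}$ the class of complete graphs. For an edge $e=uv$: $G_{ -e}$ deletes $e$, $G_{/e}$ contracts $e$, $G_{\dagger e}$ deletes $u,v$ and all incident edges. A graph parameter $F$ with values in a ring $R$ is an edge elimination invariant if there are $\alpha,\beta,\gamma\in R$ with $F(G)=F(G_{ -e})+\alpha F(G_{/e})+\beta F(G_{\dagger e})$ for all $G$ and $e\in E(G)$, $F(\emptyset)=1$, $F(K_1)=\gamma$, and $F(G\sqcup H)=F(G)F(H)$ for all $G,H$. -}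

module Defs where

open import Data.Bool using (Bool; true; false; _∧_; _∨_; not; if_then_else_)
open import Data.Nat as ℕ using (ℕ; zero; suc; _+_; _≡ᵇ_)
open import Data.Fin using (Fin; toℕ; splitAt; punchIn; punchOut)
open import Data.Integer as ℤ using (ℤ; +_)
open import Data.List using (List; []; _∷_; map; concatMap; foldr; upTo; allFin)
open import Data.Bool.ListAction using (any; all)
open import Data.Vec using (Vec; []; _∷_; lookup)
open import Data.Sum using (_⊎_; inj₁; inj₂)
open import Data.Product using (Σ; _×_; _,_)
open import Data.Empty using (⊥)
open import Relation.Binary.PropositionalEquality using (_≡_; _≢_; refl; sym; trans; cong)
open import Relation.Nullary using (¬_)

-- A graph is given by a raw Boolean relation; its adjacency is the
-- symmetric, irreflexive closure, so every value is a finite simple graph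
-- and every finite simple graph (up to iso) arises.

record Graph (n : ℕ) : Set where
  constructor graph
  field rel : Fin n → Fin n → Bool
open Graph public

_==ᶠ_ : ∀ {n} → Fin n → Fin n → Bool
i ==ᶠ j = toℕ i ≡ᵇ toℕ j

adj : ∀ {n} → Graph n → Fin n → Fin n → Bool
adj G i j = not (i ==ᶠ j) ∧ (rel G i j ∨ rel G j i)

≡ᵇ-refl : ∀ k → (k ≡ᵇ k) ≡ true
≡ᵇ-refl zero = refl
≡ᵇ-refl (suc k) = ≡ᵇ-refl k

adj-irrefl : ∀ {n} (G : Graph n) (u : Fin n) → adj G u u ≡ false
adj-irrefl G u rewrite ≡ᵇ-refl (toℕ u) = refl

true≢false : true ≡ false → ⊥
true≢false ()

edge⇒≢ : ∀ {n} (G : Graph n) {u v : Fin n} → adj G u v ≡ true → v ≢ u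
edge⇒≢ G {u} e refl = true≢false (trans (sym e) (adj-irrefl G u))

∅G : Graph 0
∅G = graph (λ ())

K₁ : Graph 1
K₁ = graph (λ _ _ → false)

private
  sumRel : ∀ {m n} → (Fin m → Fin m → Bool) → (Fin n → Fin n → Bool)
         → Fin m ⊎ Fin n → Fin m ⊎ Fin n → Bool
  sumRel r s (inj₁ a) (inj₁ b) = r a b
  sumRel r s (inj₂ a) (inj₂ b) = s a b
  sumRel r s _ _ = false

_⊔_ : ∀ {m n} → Graph m → Graph n → Graph (m + n)
_⊔_ {m} G H = graph (λ i j → sumRel (adj G) (adj H) (splitAt m i) (splitAt m j))

delete : ∀ {n} → Graph n → Fin n → Fin n → Graph n
delete G u v = graph (λ i j → adj G i j ∧ not ((i ==ᶠ u ∧ j ==ᶠ v) ∨ (i ==ᶠ v ∧ j ==ᶠ u)))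

-- edge contraction G/e, e = uv : v is merged into u
contract : ∀ {m} (G : Graph (suc m)) (u v : Fin (suc m)) → Graph m
contract G u v = graph λ i j →
  adj G (punchIn v i) (punchIn v j)
  ∨ (punchIn v i ==ᶠ u ∧ adj G v (punchIn v j))
  ∨ (punchIn v j ==ᶠ u ∧ adj G v (punchIn v i))

-- G†e : delete both endpoints u, v of e (needs u ≠ v)
dagger : ∀ {m} (G : Graph (suc (suc m))) (u v : Fin (suc (suc m))) → v ≢ u → Graph m
dagger G u v v≢u = graph λ i j → adj G (f i) (f j)
  where
    u' = punchOut v≢u
    f = λ i → punchIn v (punchIn u' i)

Subset : ℕ → Set
Subset n = Fin n → Bool

-- a (decidable) graph property, evaluated on the induced subgraph G[S]
Property : Set
Property = ∀ {n} → Graph n → Subset n → Bool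

reach : ∀ {n} → Graph n → Subset n → ℕ → Fin n → Fin n → Bool
reach G S zero i j = i ==ᶠ j
reach {n} G S (suc k) i j =
  reach G S k i j ∨ any (λ r → S r ∧ reach G S k i r ∧ adj G r j) (allFin n)

-- G[S] connected: any two vertices of S are joined by a walk inside S
-- (walks of length ≤ n suffice)
connectedP : Property
connectedP {n} G S =
  all (λ i → all (λ j → not (S i ∧ S j) ∨ reach G S n i j) (allFin n)) (allFin n)

completeP : Property
completeP {n} G S =
  all (λ i → all (λ j → not (S i ∧ S j ∧ not (i ==ᶠ j)) ∨ adj G i j) (allFin n)) (allFin n)

-- Set partitions of Fin n, encoded bijectively by restricted growth
-- strings s (s₀ = 0, s_{t} ≤ 1 + max(s₀..s_{t-1})), paired with the
-- number of blocks.  Vertex i lies in block (lookup s i).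

rgs : (n k : ℕ) → List (Vec ℕ n × ℕ)
rgs zero k = ([] , k) ∷ []
rgs (suc n) k = concatMap
  (λ c → map (λ { (s , b) → (c ∷ s , b) }) (rgs n (if c ≡ᵇ k then suc k else k)))
  (upTo (suc k))

partitions : (n : ℕ) → List (Vec ℕ n × ℕ)
partitions n = rgs n 0

block : ∀ {n} → Vec ℕ n → ℕ → Subset n
block s c i = lookup s i ≡ᵇ c

goodPartition : Property → ∀ {n} → Graph n → Vec ℕ n × ℕ → Bool
goodPartition P G (s , k) = all (λ c → P G (block s c)) (upTo k)

count : ∀ {A : Set} → (A → Bool) → List A → ℕ
count f = foldr (λ a acc → if f a then suc acc else acc) 0

bP : Property → ∀ {n} → Graph n → ℕ → ℕ
bP P {n} G i = count (λ { (s , k) → goodPartition P G (s , k) ∧ (k ≡ᵇ i) }) (partitions n)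

ff : ℤ → ℕ → ℤ
ff x zero = ℤ.1ℤ
ff x (suc i) = ff x i ℤ.* (x ℤ.- + i)

-- polynomials with integer coefficients are identified with their
-- polynomial functions ℤ → ℤ (faithful since ℤ is infinite)
χ : Property → ∀ {n} → Graph n → ℤ → ℤ
χ P {n} G x = foldr (λ i acc → (+ bP P G i) ℤ.* ff x i ℤ.+ acc) ℤ.0ℤ (upTo (suc n))

C : ∀ {n} → Graph n → ℤ → ℤ
C = χ connectedP

A : ∀ {n} → Graph n → ℤ → ℤ
A = χ completeP

Poly : Set
Poly = List ℤ   -- coefficient list, constant term first

eval : Poly → ℤ → ℤ
eval [] x = ℤ.0ℤ
eval (a ∷ p) x = a ℤ.+ x ℤ.* eval p x

GraphParam : Set
GraphParam = ∀ {n} → Graph n → ℤ → ℤ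

-- every graph with an edge has ≥ 2 vertices, so quantifying over
-- Graph (suc (suc m)) covers all (G, e)
IsEdgeEliminationInvariant : GraphParam → Set
IsEdgeEliminationInvariant F =
  Σ Poly λ α → Σ Poly λ β → Σ Poly λ γ →
    (∀ m (G : Graph (suc (suc m))) (u v : Fin (suc (suc m))) (e : adj G u v ≡ true) (x : ℤ) →
       F G x ≡ F (delete G u v) x
               ℤ.+ eval α x ℤ.* F (contract G u v) x
               ℤ.+ eval β x ℤ.* F (dagger G u v (edge⇒≢ G e)) x)
  × (∀ x → F ∅G x ≡ ℤ.1ℤ)
  × (∀ x → F K₁ x ≡ eval γ x)
  × (∀ m n (G : Graph m) (H : Graph n) x → F (G ⊔ H) x ≡ F G x ℤ.* F H x)

NotMultiplicative : GraphParam → Set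
NotMultiplicative F =
  Σ ℕ λ m → Σ ℕ λ n → Σ (Graph m) λ G₁ → Σ (Graph n) λ G₂ →
    ¬ (∀ x → F (G₁ ⊔ G₂) x ≡ F G₁ x ℤ.* F G₂ x)

-- An edge elimination invariant is multiplicative by definition, so it suffices to
-- find one pair of graphs on which C and A are not multiplicative.  K₁ and the
-- edgeless graph K₁ ⊔ K₁ admit only their partitions into singletons, so both
-- polynomials are x on K₁ but x(x − 1) ≠ x² on K₁ ⊔ K₁.
module Submission where

open import Defs
open import Data.Integer using (+_; _*_; _+_; _-_; 0ℤ; 1ℤ)
open import Data.Integer.Properties using (+-identityˡ; *-identityˡ)
open import Data.Integer.Tactic.RingSolver using (solve-∀)
open import Data.Product using (_×_; _,_)
open import Relation.Nullary using (¬_)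
open import Relation.Binary.PropositionalEquality
  using (_≡_; refl; sym; cong₂; module ≡-Reasoning)
open ≡-Reasoning

notMultiplicative⇒¬edgeEliminationInvariant :
  ∀ {F : GraphParam} → NotMultiplicative F → ¬ IsEdgeEliminationInvariant F
notMultiplicative⇒¬edgeEliminationInvariant (m , n , G , H , ¬mult)
  (_ , _ , _ , _ , _ , _ , mult) = ¬mult (mult m n G H)

χ-order₁ : ∀ (P : Property) (G : Graph 1) x → χ P G x ≡ + bP P G 0 + + bP P G 1 * x
χ-order₁ P G x = expand (+ bP P G 0) (+ bP P G 1) x
  where
  expand : ∀ b₀ b₁ x → b₀ * 1ℤ + (b₁ * (1ℤ * (x - + 0)) + 0ℤ) ≡ b₀ + b₁ * x
  expand = solve-∀

χ-order₂ : ∀ (P : Property) (G : Graph 2) x →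
           χ P G x ≡ + bP P G 0 + + bP P G 1 * x + + bP P G 2 * (x * (x - 1ℤ))
χ-order₂ P G x = expand (+ bP P G 0) (+ bP P G 1) (+ bP P G 2) x
  where
  expand : ∀ b₀ b₁ b₂ x →
           b₀ * 1ℤ + (b₁ * (1ℤ * (x - + 0)) + (b₂ * (1ℤ * (x - + 0) * (x - + 1)) + 0ℤ))
           ≡ b₀ + b₁ * x + b₂ * (x * (x - 1ℤ))
  expand = solve-∀

χ-K₁ : ∀ (P : Property) → bP P K₁ 0 ≡ 0 → bP P K₁ 1 ≡ 1 → ∀ x → χ P K₁ x ≡ x
χ-K₁ P b₀≡0 b₁≡1 x = begin
  χ P K₁ x                       ≡⟨ χ-order₁ P K₁ x ⟩
  + bP P K₁ 0 + + bP P K₁ 1 * x  ≡⟨ cong₂ (λ b₀ b₁ → + b₀ + + b₁ * x) b₀≡0 b₁≡1 ⟩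
  + 0 + + 1 * x                  ≡⟨ +-identityˡ (+ 1 * x) ⟩
  + 1 * x                        ≡⟨ *-identityˡ x ⟩
  x                              ∎

χ-K₁⊔K₁ : ∀ (P : Property) → bP P (K₁ ⊔ K₁) 0 ≡ 0 → bP P (K₁ ⊔ K₁) 1 ≡ 0 →
          bP P (K₁ ⊔ K₁) 2 ≡ 1 → ∀ x → χ P (K₁ ⊔ K₁) x ≡ x * (x - 1ℤ)
χ-K₁⊔K₁ P b₀≡0 b₁≡0 b₂≡1 x = begin
  χ P (K₁ ⊔ K₁) x
    ≡⟨ χ-order₂ P (K₁ ⊔ K₁) x ⟩
  + bP P (K₁ ⊔ K₁) 0 + + bP P (K₁ ⊔ K₁) 1 * x + + bP P (K₁ ⊔ K₁) 2 * (x * (x - 1ℤ))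
    ≡⟨ cong₂ (λ b b₂ → b + + b₂ * (x * (x - 1ℤ)))
             (cong₂ (λ b₀ b₁ → + b₀ + + b₁ * x) b₀≡0 b₁≡0) b₂≡1 ⟩
  0ℤ + + 1 * (x * (x - 1ℤ))
    ≡⟨ +-identityˡ _ ⟩
  + 1 * (x * (x - 1ℤ))
    ≡⟨ *-identityˡ _ ⟩
  x * (x - 1ℤ)
    ∎

-- At x = 1 the two sides are 0 and 1.
notMultiplicative-K₁⊔K₁ : ∀ {F : GraphParam} → (∀ x → F K₁ x ≡ x) →
                          (∀ x → F (K₁ ⊔ K₁) x ≡ x * (x - 1ℤ)) → NotMultiplicative F
notMultiplicative-K₁⊔K₁ {F} F-K₁ F-K₁⊔K₁ = 1 , 1 , K₁ , K₁ , λ mult → zero≢one (begin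
  0ℤ                        ≡⟨ sym (F-K₁⊔K₁ 1ℤ) ⟩
  F (K₁ ⊔ K₁) 1ℤ            ≡⟨ mult 1ℤ ⟩
  F K₁ 1ℤ * F K₁ 1ℤ         ≡⟨ cong₂ _*_ (F-K₁ 1ℤ) (F-K₁ 1ℤ) ⟩
  1ℤ                        ∎)
  where
  zero≢one : ¬ 0ℤ ≡ 1ℤ
  zero≢one ()

proposition3 : NotMultiplicative C × NotMultiplicative A
                   × ¬ IsEdgeEliminationInvariant C × ¬ IsEdgeEliminationInvariant A
proposition3 =
  notMultiplicative-C , notMultiplicative-A ,
  notMultiplicative⇒¬edgeEliminationInvariant {C} notMultiplicative-C ,
  notMultiplicative⇒¬edgeEliminationInvariant {A} notMultiplicative-A
  where
  notMultiplicative-C : NotMultiplicative C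
  notMultiplicative-C = notMultiplicative-K₁⊔K₁ {C}
    (χ-K₁ connectedP refl refl) (χ-K₁⊔K₁ connectedP refl refl refl)

  notMultiplicative-A : NotMultiplicative A
  notMultiplicative-A = notMultiplicative-K₁⊔K₁ {A}
    (χ-K₁ completeP refl refl) (χ-K₁⊔K₁ completeP refl refl refl)
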